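{- Let $k,\ell\ge 1$ be integers. For a prime $p$ and an integer $j\ge 1$ define $$A_{k,\ell}(p^j)=\left(1-\frac1p\right)^{k+\ell-2}\sum_{\alpha\ge j}\binom{k+\alpha-2}{k-2}p^{j-\alpha}\sum_{\beta\ge j}\binom{\ell+\beta-2}{\ell-2}p^{j-\beta},$$ and for an integer $m\ge 0$ and a real $s>0$ (where the series converges) define $$\sigma_m(p^j,s)=\left(1-\frac1p\right)^m\sum_{i=0}^\infty\frac{\tau_m(p^{j+i})}{p^{is}}.$$ Let $D_p=\left(1-\frac1p\right)^{k-1}+\left(1-\frac1p\right)^{\ell-1}-\left(1-\frac1p\right)^{k+\ell-2}$. (i) One has $$\prod_p\left(1-\left(1-\left(1-\frac1p\right)^{k-1}\right)\left(1-\left(1-\frac1p\right)^{\ell-1}\right)\right)=\prod_p D_p .$$ (ii) For every nonzero integer $h$, with $\nu_p(h)$ the exponent of the highest power of $p$ dividing $h$, $$\prod_{p\mid h}\frac{1+\sum_{1\le j\le \nu_p(h)}(p^j-p^{j-1})\frac{A_{k,\ell}(p^j)}{p^{2j}}-p^{\nu_p(h)}\frac{A_{k,\ell}(p^{\nu_p(h)+1})}{p^{2(\nu_p(h)+1)}}}{1-\left(1-\left(1-\frac1p\right)^{k-1}\right)\left(1-\left(1-\frac1p\right)^{\ell-1}\right)} =\prod_{p\mid h} g_{k,\ell}(p^{\nu_p(h)}),$$ where for a prime $p$ and integer $\alpha\ge1$ $$g_{k,\ell}(p^\alpha)=\frac{\sum_{j=0}^{\alpha}\left(\frac{\sigma_{k-1}(p^j,1)\sigma_{\ell-1}(p^j,1)}{p^j}-\frac{\sigma_{k-1}(p^{j+1},1)\sigma_{\ell-1}(p^{j+1},1)}{p^{j+2}}\right)}{D_p};$$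 in fact the factors agree prime by prime.
   Context: Products and sums over $p$ range over primes. $\tau_m(n)$ is the $m$-fold divisor function (number of ways to write $n$ as an ordered product of $m$ positive integers), with $\tau_0$ the identity for Dirichlet convolution ($\tau_0(1)=1$, $\tau_0(n)=0$ for $n>1$); thus $\tau_m(p^j)=\binom{m+j-1}{m-1}$. Binomial coefficients $\binom{n}{r}$ with $r<0$ are taken to be $0$ (for $r\ge 0$, $\binom{n}{r}$ is the usual polynomial in $n$). The left-hand product in (ii) is the function denoted $f_{k,\ell}(h)$ and the product in (i) the constant $C_{k,\ell}$; the right-hand sides are the forms given by Ng and Thom. -}

module Defs where

open import Data.Nat as ℕ using (ℕ; zero; suc; _≤_; _∸_)
open import Data.Nat.Combinatorics using (_C_)
open import Data.Nat.Divisibility using (_∣_; _∣?_)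
open import Data.Nat.DivMod using (_/_)
open import Data.Nat.Primality using (Prime; prime?)
open import Data.Integer as ℤ using (ℤ; +_)
open import Data.Rational as ℚ using (ℚ; 0ℚ; 1ℚ; _+_; _*_; _-_; _<_; ∣_∣)
open import Data.Rational.Properties using (_≟_)
open import Data.List using (List; []; _∷_; filter; foldr; map; upTo)
open import Data.Product using (_×_; ∃-syntax)
open import Relation.Nullary using (yes; no)
open import Relation.Nullary.Decidable using (_×-dec_)
open import Relation.Binary.PropositionalEquality using (_≡_)

toℚ : ℕ → ℚ
toℚ n = (+ n) ℚ./ 1

-- 1/n as a rational (only ever used with n ≥ 1; value 0 at n = 0)
inv : ℕ → ℚ
inv zero    = 0ℚ
inv (suc n) = (+ 1) ℚ./ suc n

-- total division on ℚ (only ever used with nonzero denominators)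
divℚ : ℚ → ℚ → ℚ
divℚ x y with y ≟ 0ℚ
... | yes _ = 0ℚ
... | no y≢0 = ℚ._÷_ x y {{ℚ.≢-nonZero y≢0}}

powℚ : ℚ → ℕ → ℚ
powℚ x zero    = 1ℚ
powℚ x (suc n) = x * powℚ x n

sumℚ : ℕ → (ℕ → ℚ) → ℚ
sumℚ zero    f = 0ℚ
sumℚ (suc n) f = sumℚ n f + f n

-- Σ_{a ≤ j ≤ b} f j   (empty if b < a)
sumRange : ℕ → ℕ → (ℕ → ℚ) → ℚ
sumRange a b f = sumℚ (suc b ∸ a) (λ i → f (a ℕ.+ i))

prodList : List ℚ → ℚ
prodList = foldr _*_ 1ℚ

SumsTo : (ℕ → ℚ) → ℚ → Set
SumsTo f q = ∀ (ε : ℚ) → 0ℚ < ε → ∃[ N ] (∀ n → N ≤ n → ∣ sumℚ n f - q ∣ < ε)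

Cauchy : (ℕ → ℚ) → Set
Cauchy s = ∀ (ε : ℚ) → 0ℚ < ε → ∃[ N ] (∀ m n → N ≤ m → N ≤ n → ∣ s m - s n ∣ < ε)

SameLimit : (ℕ → ℚ) → (ℕ → ℚ) → Set
SameLimit s t = ∀ (ε : ℚ) → 0ℚ < ε → ∃[ N ] (∀ n → N ≤ n → ∣ s n - t n ∣ < ε)

primesUpTo : ℕ → List ℕ
primesUpTo N = filter prime? (upTo (suc N))

partialProdPrimes : (ℕ → ℚ) → ℕ → ℚ
partialProdPrimes f N = prodList (map f (primesUpTo N))

primeDivisors : ℕ → List ℕ
primeDivisors n = filter (λ p → prime? p ×-dec p ∣? n) (upTo (suc n))

-- p-adic valuation ν_p(n): exponent of the highest power of p dividing n
-- (computed by repeated division, with fuel; meaningful for p ≥ 2, n ≥ 1)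
νAux : ℕ → ℕ → ℕ → ℕ
νAux zero       p n = 0
νAux (suc fuel) zero n = 0
νAux (suc fuel) (suc zero) n = 0
νAux (suc fuel) (suc (suc q)) zero = 0
νAux (suc fuel) (suc (suc q)) (suc m) with suc (suc q) ∣? suc m
... | yes _ = suc (νAux fuel (suc (suc q)) (suc m / suc (suc q)))
... | no  _ = 0

ν : ℕ → ℕ → ℕ
ν p n = νAux n p n

sumDivisors : ℕ → (ℕ → ℚ) → ℚ
sumDivisors n f = foldr _+_ 0ℚ (map f (filter (λ d → d ∣? n) (upTo (suc n))))

-- τ_m(n): number of ordered factorisations of n into m positive factors.
-- τ_0 is the Dirichlet identity; τ_{m+1}(n) = Σ_{d ∣ n} τ_m(n/d).
τ : ℕ → ℕ → ℚ
τ zero    n with n ℕ.≟ 1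
... | yes _ = 1ℚ
... | no  _ = 0ℚ
τ (suc m) zero    = 0ℚ
τ (suc m) (suc n) = sumDivisors (suc n) (λ d → τ m (qt d))
  where
  qt : ℕ → ℕ
  qt zero    = 0
  qt (suc d) = suc n / suc d

-- binom(k + α - 2, k - 2), with binom(·, r) = 0 for r < 0 (i.e. k = 1); α ≥ 1
binomK : ℕ → ℕ → ℚ
binomK zero          α = 0ℚ
binomK (suc zero)    α = 0ℚ
binomK (suc (suc k)) α = toℚ ((k ℕ.+ α) C k)

oneMinusInv : ℕ → ℚ
oneMinusInv p = 1ℚ - inv p

Dp : ℕ → ℕ → ℕ → ℚ
Dp k ℓ p = (powℚ (oneMinusInv p) (k ∸ 1) + powℚ (oneMinusInv p) (ℓ ∸ 1))
           - powℚ (oneMinusInv p) ((k ℕ.+ ℓ) ∸ 2)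

Cfactor : ℕ → ℕ → ℕ → ℚ
Cfactor k ℓ p = 1ℚ - (1ℚ - powℚ (oneMinusInv p) (k ∸ 1)) * (1ℚ - powℚ (oneMinusInv p) (ℓ ∸ 1))

-- The j-th term (α = j + i) of Σ_{α ≥ j} binom(m+α-2, m-2) p^{j-α}
binomSeriesTerm : ℕ → ℕ → ℕ → ℕ → ℚ
binomSeriesTerm m p j i = binomK m (j ℕ.+ i) * inv (p ℕ.^ i)

-- The i-th term of Σ_{i ≥ 0} τ_m(p^{j+i}) / p^{i·1}   (s = 1)
tauSeriesTerm : ℕ → ℕ → ℕ → ℕ → ℚ
tauSeriesTerm m p j i = τ m (p ℕ.^ (j ℕ.+ i)) * inv (p ℕ.^ i)

BinomSums : (ℕ → ℕ → ℕ → ℚ) → Set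
BinomSums S = ∀ m p j → Prime p → 1 ≤ j → SumsTo (binomSeriesTerm m p j) (S m p j)

TauSums : (ℕ → ℕ → ℕ → ℚ) → Set
TauSums T = ∀ m p j → Prime p → SumsTo (tauSeriesTerm m p j) (T m p j)

Akl : (ℕ → ℕ → ℕ → ℚ) → ℕ → ℕ → ℕ → ℕ → ℚ
Akl S k ℓ p j = powℚ (oneMinusInv p) ((k ℕ.+ ℓ) ∸ 2) * (S k p j * S ℓ p j)

σ1 : (ℕ → ℕ → ℕ → ℚ) → ℕ → ℕ → ℕ → ℚ
σ1 T m p j = powℚ (oneMinusInv p) m * T m p j

fFactor : (ℕ → ℕ → ℕ → ℚ) → ℕ → ℕ → ℕ → ℕ → ℚ
fFactor S k ℓ p a =
  divℚ ((1ℚ + sumRange 1 a (λ j → (toℚ (p ℕ.^ j) - toℚ (p ℕ.^ (j ∸ 1)))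
                                     * (Akl S k ℓ p j * inv (p ℕ.^ (2 ℕ.* j)))))
          - toℚ (p ℕ.^ a) * (Akl S k ℓ p (suc a) * inv (p ℕ.^ (2 ℕ.* suc a))))
       (Cfactor k ℓ p)

gFactor : (ℕ → ℕ → ℕ → ℚ) → ℕ → ℕ → ℕ → ℕ → ℚ
gFactor T k ℓ p a =
  divℚ (sumRange 0 a (λ j →
          (σ1 T (k ∸ 1) p j * σ1 T (ℓ ∸ 1) p j) * inv (p ℕ.^ j)
        - (σ1 T (k ∸ 1) p (suc j) * σ1 T (ℓ ∸ 1) p (suc j)) * inv (p ℕ.^ (j ℕ.+ 2))))
       (Dp k ℓ p)

prodOverPrimeDivisors : ℤ → (ℕ → ℕ → ℚ) → ℚ
prodOverPrimeDivisors h F = prodList (map (λ p → F p (ν p ℤ.∣ h ∣)) (primeDivisors ℤ.∣ h ∣))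

{-# OPTIONS --safe #-}
module Submission where

-- (i) holds factor by factor, since 1 - (1 - X)(1 - Y) = X + Y - XY.  The partial products
-- are Cauchy because every factor lies in [0,1] and, by Bernoulli's inequality, differs from 1
-- by at most (k-1)(ℓ-1)/p² ≤ (k-1)(ℓ-1)(1/(p-1) - 1/p), which telescopes.
--
-- (ii) At a prime p the divisors of p^α are the p^t, so τ_{m+1}(p^{α+1}) = τ_{m+1}(p^α) + τ_m(p^{α+1}).
-- Hence τ_m(p^α) = binom(m+α-1, m-1), so the binomial series in A_{k,ℓ}(p^j) are the τ-series of
-- σ_{k-1} and σ_{ℓ-1}; and summing the recursion against p^{-i} gives
-- (1 - 1/p) Σ τ_{m+1}(p^i) p^{-i} = Σ τ_m(p^i) p^{-i}, so σ_m(1, 1) = 1.  With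
-- B_j = σ_{k-1}(p^j,1) σ_{ℓ-1}(p^j,1) this means A_{k,ℓ}(p^j) = B_j for j ≥ 1 and B_0 = 1, and then
-- the numerators of both factors are the same telescoping sum.

open import Defs

-- Kept in a module: its ℚ-valued _≤_ and ∣_∣ would clash with the ℕ and ℤ ones of the statement.
module EulerFactors where

  open import Algebra.Bundles using (CommutativeMonoid)
  open import Data.Bool using (if_then_else_)
  open import Data.Empty using (⊥-elim)
  import Data.Integer as ℤ
  import Data.Integer.Properties as ℤ
  import Data.Integer.Tactic.RingSolver as ℤ-Solver
  open import Data.List as List using ([]; _∷_; _++_; [_]; map; filter; upTo)
  import Data.List.Properties as List
  open import Data.Nat as ℕ using (ℕ; zero; suc; z≤n; s≤s; _^_; _∸_; NonZero)
  import Data.Nat.Properties as ℕ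
  import Data.Nat.Tactic.RingSolver as ℕ-Solver
  open import Data.Nat.Combinatorics using (_C_; nCn≡1; nCk+nC[k+1]≡[n+1]C[k+1])
  open import Data.Nat.Coprimality using (Coprime; coprime-divisor)
  open import Data.Nat.Divisibility using (_∣_; _∣?_; divides; ∣-refl; ∣-trans; ∣⇒≤; ∣1⇒≡1; *-cancelˡ-∣; n∣m*n)
  open import Data.Nat.DivMod using (_/_; m*n/n≡m)
  open import Data.Nat.Primality using (Prime; prime?; prime⇒irreducible; ¬prime[0]; ¬prime[1])
  open import Data.Product using (∃-syntax; _×_; _,_; proj₁; proj₂)
  open import Data.Rational as ℚ using (ℚ; mkℚ; 0ℚ; 1ℚ; ½; _+_; _*_; _-_; -_; _≤_; _<_; ∣_∣)
  import Data.Rational.Properties as ℚ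
  open import Data.Rational.Solver using (module +-*-Solver)
  open import Data.Rational.Unnormalised as ℚᵘ using (mkℚᵘ; *≡*; *≤*; *<*)
  import Data.Rational.Unnormalised.Properties as ℚᵘ
  open import Data.Sum using (inj₁; inj₂)
  open import Function using (_∘_)
  open import Relation.Binary using (tri<; tri≈; tri>)
  open import Relation.Binary.PropositionalEquality using (_≡_; _≢_; refl; sym; trans; cong; cong₂; subst; subst₂; module ≡-Reasoning)
  open import Relation.Nullary using (yes; no; does; ¬_; _×-dec_)
  open import Relation.Nullary.Decidable using (dec-true; dec-false)
  open import Relation.Unary using (Pred; Decidable)
  open import Algebra.Properties.CommutativeSemigroup (CommutativeMonoid.commutativeSemigroup ℚ.*-1-commutativeMonoid)
    using () renaming (interchange to *-interchange)
  open import Algebra.Properties.CommutativeSemigroup (CommutativeMonoid.commutativeSemigroup ℚ.+-0-commutativeMonoid)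
    using () renaming (interchange to +-interchange)
  open +-*-Solver

  private
    subst₂-≤ : ∀ {a b u v : ℚ} → a ≡ u → b ≡ v → a ≤ b → u ≤ v
    subst₂-≤ refl refl a≤b = a≤b

  toℚᵘ-toℚ/ : ∀ a d → ℚ.toℚᵘ ((ℤ.+ a) ℚ./ suc d) ℚᵘ.≃ mkℚᵘ (ℤ.+ a) d
  toℚᵘ-toℚ/ a d = ℚ.toℚᵘ-fromℚᵘ (mkℚᵘ (ℤ.+ a) d)

  toℚ-suc : ∀ n → toℚ (suc n) ≡ 1ℚ + toℚ n
  toℚ-suc n = ℚ.toℚᵘ-injective (begin
    ℚ.toℚᵘ (toℚ (suc n))             ≈⟨ toℚᵘ-toℚ/ (suc n) 0 ⟩
    mkℚᵘ (ℤ.+ suc n) 0                 ≈⟨ *≡* (trans (cong (ℤ._* ℤ.1ℤ) (ℤ.pos-+ 1 n)) (lemma (ℤ.+ n))) ⟩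
    mkℚᵘ (ℤ.+ 1) 0 ℚᵘ.+ mkℚᵘ (ℤ.+ n) 0  ≈⟨ ℚᵘ.+-cong (toℚᵘ-toℚ/ 1 0) (toℚᵘ-toℚ/ n 0) ⟨
    ℚ.toℚᵘ 1ℚ ℚᵘ.+ ℚ.toℚᵘ (toℚ n)   ≈⟨ ℚ.toℚᵘ-homo-+ 1ℚ (toℚ n) ⟨
    ℚ.toℚᵘ (1ℚ + toℚ n)              ∎)
    where
    open ℚᵘ.≃-Reasoning
    lemma : ∀ a → (ℤ.1ℤ ℤ.+ a) ℤ.* ℤ.1ℤ ≡ (ℤ.1ℤ ℤ.* ℤ.1ℤ ℤ.+ a ℤ.* ℤ.1ℤ) ℤ.* ℤ.1ℤ
    lemma = ℤ-Solver.solve-∀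

  toℚ-+ : ∀ m n → toℚ (m ℕ.+ n) ≡ toℚ m + toℚ n
  toℚ-+ zero    n = sym (ℚ.+-identityˡ (toℚ n))
  toℚ-+ (suc m) n = begin
    toℚ (suc (m ℕ.+ n))   ≡⟨ toℚ-suc (m ℕ.+ n) ⟩
    1ℚ + toℚ (m ℕ.+ n)    ≡⟨ cong (1ℚ +_) (toℚ-+ m n) ⟩
    1ℚ + (toℚ m + toℚ n)  ≡⟨ ℚ.+-assoc 1ℚ (toℚ m) (toℚ n) ⟨
    (1ℚ + toℚ m) + toℚ n  ≡⟨ cong (_+ toℚ n) (toℚ-suc m) ⟨
    toℚ (suc m) + toℚ n   ∎
    where open ≡-Reasoning

  toℚ-* : ∀ m n → toℚ (m ℕ.* n) ≡ toℚ m * toℚ n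
  toℚ-* zero    n = sym (ℚ.*-zeroˡ (toℚ n))
  toℚ-* (suc m) n = begin
    toℚ (n ℕ.+ m ℕ.* n)    ≡⟨ toℚ-+ n (m ℕ.* n) ⟩
    toℚ n + toℚ (m ℕ.* n)  ≡⟨ cong (toℚ n +_) (toℚ-* m n) ⟩
    toℚ n + toℚ m * toℚ n  ≡⟨ solve 2 (λ a b → b :+ a :* b := (con 1ℚ :+ a) :* b) refl (toℚ m) (toℚ n) ⟩
    (1ℚ + toℚ m) * toℚ n   ≡⟨ cong (_* toℚ n) (toℚ-suc m) ⟨
    toℚ (suc m) * toℚ n    ∎
    where open ≡-Reasoning

  toℚ-^ : ∀ m n → toℚ (m ^ n) ≡ powℚ (toℚ m) n
  toℚ-^ m zero    = refl
  toℚ-^ m (suc n) = trans (toℚ-* m (m ^ n)) (cong (toℚ m *_) (toℚ-^ m n))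

  inv*toℚ≡1 : ∀ n → inv (suc n) * toℚ (suc n) ≡ 1ℚ
  inv*toℚ≡1 n = ℚ.toℚᵘ-injective (begin
    ℚ.toℚᵘ (inv (suc n) * toℚ (suc n))              ≈⟨ ℚ.toℚᵘ-homo-* (inv (suc n)) (toℚ (suc n)) ⟩
    ℚ.toℚᵘ (inv (suc n)) ℚᵘ.* ℚ.toℚᵘ (toℚ (suc n))  ≈⟨ ℚᵘ.*-cong (toℚᵘ-toℚ/ 1 n) (toℚᵘ-toℚ/ (suc n) 0) ⟩
    mkℚᵘ (ℤ.+ 1) n ℚᵘ.* mkℚᵘ (ℤ.+ suc n) 0              ≈⟨ *≡* (cong (λ z → ℤ.+ suc z) (lemma n)) ⟩
    ℚ.toℚᵘ 1ℚ                                        ∎)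
    where
    open ℚᵘ.≃-Reasoning
    lemma : ∀ n → (n ℕ.+ 0 ℕ.* suc n) ℕ.* 1 ≡ n ℕ.* 1 ℕ.+ 0 ℕ.* suc (n ℕ.* 1)
    lemma = ℕ-Solver.solve-∀

  inv-unique : ∀ n q → q * toℚ (suc n) ≡ 1ℚ → q ≡ inv (suc n)
  inv-unique n q q*n≡1 = begin
    q                                ≡⟨ ℚ.*-identityʳ q ⟨
    q * 1ℚ                           ≡⟨ cong (q *_) (inv*toℚ≡1 n) ⟨
    q * (inv (suc n) * toℚ (suc n))  ≡⟨ solve 3 (λ a b c → a :* (b :* c) := (a :* c) :* b) refl q (inv (suc n)) (toℚ (suc n)) ⟩
    (q * toℚ (suc n)) * inv (suc n)  ≡⟨ cong (_* inv (suc n)) q*n≡1 ⟩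
    1ℚ * inv (suc n)                 ≡⟨ ℚ.*-identityˡ _ ⟩
    inv (suc n)                      ∎
    where open ≡-Reasoning

  inv-* : ∀ m n → inv (suc m ℕ.* suc n) ≡ inv (suc m) * inv (suc n)
  inv-* m n = sym (inv-unique (n ℕ.+ m ℕ.* suc n) _ (begin
    (inv (suc m) * inv (suc n)) * toℚ (suc m ℕ.* suc n)          ≡⟨ cong ((inv (suc m) * inv (suc n)) *_) (toℚ-* (suc m) (suc n)) ⟩
    (inv (suc m) * inv (suc n)) * (toℚ (suc m) * toℚ (suc n))    ≡⟨ *-interchange (inv (suc m)) (inv (suc n)) (toℚ (suc m)) (toℚ (suc n)) ⟩
    (inv (suc m) * toℚ (suc m)) * (inv (suc n) * toℚ (suc n))    ≡⟨ cong₂ _*_ (inv*toℚ≡1 m) (inv*toℚ≡1 n) ⟩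
    1ℚ * 1ℚ                                                      ∎))
    where open ≡-Reasoning

  suc^≡suc : ∀ m n → ∃[ r ] suc m ^ n ≡ suc r
  suc^≡suc m zero    = 0 , refl
  suc^≡suc m (suc n) with suc^≡suc m n
  ... | r , eq = r ℕ.+ m ℕ.* suc r , cong (suc m ℕ.*_) eq

  inv-^ : ∀ m n → inv (suc m ^ n) ≡ powℚ (inv (suc m)) n
  inv-^ m zero    = refl
  inv-^ m (suc n) with suc^≡suc m n
  ... | r , eq = begin
    inv (suc m ℕ.* suc m ^ n)            ≡⟨ cong (λ z → inv (suc m ℕ.* z)) eq ⟩
    inv (suc m ℕ.* suc r)                ≡⟨ inv-* m r ⟩
    inv (suc m) * inv (suc r)            ≡⟨ cong (λ z → inv (suc m) * inv z) eq ⟨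
    inv (suc m) * inv (suc m ^ n)        ≡⟨ cong (inv (suc m) *_) (inv-^ m n) ⟩
    inv (suc m) * powℚ (inv (suc m)) n   ∎
    where open ≡-Reasoning

  inv[1+n]-inv[2+n]≡inv[1+n]*inv[2+n] : ∀ n → inv (suc n) - inv (suc (suc n)) ≡ inv (suc n) * inv (suc (suc n))
  inv[1+n]-inv[2+n]≡inv[1+n]*inv[2+n] n = begin
    z - y                                              ≡⟨ solve 2 (λ z y → z :- y := z :* con 1ℚ :- y :* con 1ℚ) refl z y ⟩
    z * 1ℚ - y * 1ℚ                                    ≡⟨ cong₂ (λ u v → z * u - y * v) (inv*toℚ≡1 (suc n)) (inv*toℚ≡1 n) ⟨
    z * (y * toℚ (suc (suc n))) - y * (z * toℚ (suc n)) ≡⟨ cong (λ u → z * (y * u) - y * (z * toℚ (suc n))) (toℚ-suc (suc n)) ⟩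
    z * (y * (1ℚ + toℚ (suc n))) - y * (z * toℚ (suc n)) ≡⟨ solve 3 (λ z y w → z :* (y :* (con 1ℚ :+ w)) :- y :* (z :* w) := z :* y) refl z y (toℚ (suc n)) ⟩
    z * y                                              ∎
    where
    open ≡-Reasoning
    z = inv (suc n)
    y = inv (suc (suc n))

  powℚ-+ : ∀ x m n → powℚ x (m ℕ.+ n) ≡ powℚ x m * powℚ x n
  powℚ-+ x zero    n = sym (ℚ.*-identityˡ _)
  powℚ-+ x (suc m) n = trans (cong (x *_) (powℚ-+ x m n)) (sym (ℚ.*-assoc x _ _))

  powℚ-* : ∀ x y n → powℚ (x * y) n ≡ powℚ x n * powℚ y n
  powℚ-* x y zero    = refl
  powℚ-* x y (suc n) = trans (cong ((x * y) *_) (powℚ-* x y n))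
    (*-interchange x y (powℚ x n) (powℚ y n))

  powℚ-1 : ∀ n → powℚ 1ℚ n ≡ 1ℚ
  powℚ-1 zero    = refl
  powℚ-1 (suc n) = trans (ℚ.*-identityˡ _) (powℚ-1 n)

  ≤-cross : ∀ {p q} a b c d → ℚ.toℚᵘ p ℚᵘ.≃ mkℚᵘ (ℤ.+ a) b → ℚ.toℚᵘ q ℚᵘ.≃ mkℚᵘ (ℤ.+ c) d →
            a ℕ.* suc d ℕ.≤ c ℕ.* suc b → p ≤ q
  ≤-cross a b c d p≃ q≃ ad≤cb = ℚ.toℚᵘ-cancel-≤ (ℚᵘ.≤-respʳ-≃ (ℚᵘ.≃-sym q≃) (ℚᵘ.≤-respˡ-≃ (ℚᵘ.≃-sym p≃)
    (*≤* (subst₂ ℤ._≤_ (ℤ.pos-* a (suc d)) (ℤ.pos-* c (suc b)) (ℤ.+≤+ ad≤cb)))))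

  <-cross : ∀ {p q} a b c d → ℚ.toℚᵘ p ℚᵘ.≃ mkℚᵘ (ℤ.+ a) b → ℚ.toℚᵘ q ℚᵘ.≃ mkℚᵘ (ℤ.+ c) d →
            a ℕ.* suc d ℕ.< c ℕ.* suc b → p < q
  <-cross a b c d p≃ q≃ ad<cb = ℚ.toℚᵘ-cancel-< (ℚᵘ.<-respʳ-≃ (ℚᵘ.≃-sym q≃) (ℚᵘ.<-respˡ-≃ (ℚᵘ.≃-sym p≃)
    (*<* (subst₂ ℤ._<_ (ℤ.pos-* a (suc d)) (ℤ.pos-* c (suc b)) (ℤ.+<+ ad<cb)))))

  0≤toℚ : ∀ n → 0ℚ ≤ toℚ n
  0≤toℚ n = ≤-cross 0 0 n 0 ℚᵘ.≃-refl (toℚᵘ-toℚ/ n 0) z≤n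

  0≤inv : ∀ n → 0ℚ ≤ inv n
  0≤inv zero    = ℚ.≤-refl
  0≤inv (suc n) = ≤-cross 0 0 1 n ℚᵘ.≃-refl (toℚᵘ-toℚ/ 1 n) z≤n

  inv≤1 : ∀ n → inv n ≤ 1ℚ
  inv≤1 zero    = 0≤inv 1
  inv≤1 (suc n) = ≤-cross 1 n 1 0 (toℚᵘ-toℚ/ 1 n) ℚᵘ.≃-refl (ℕ.*-monoʳ-≤ 1 (s≤s z≤n))

  inv-antitone : ∀ n → inv (suc (suc n)) ≤ inv (suc n)
  inv-antitone n = ≤-cross 1 (suc n) 1 n (toℚᵘ-toℚ/ 1 (suc n)) (toℚᵘ-toℚ/ 1 n) (ℕ.*-monoʳ-≤ 1 (ℕ.n≤1+n (suc n)))

  -- For ε = (1+n)/(1+d), N = κ(1+d) gives κ/(1+N) < 1/(1+d) ≤ ε.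
  toℚ*inv-small : ∀ κ ε → 0ℚ < ε → ∃[ N ] toℚ κ * inv (suc N) < ε
  toℚ*inv-small κ (mkℚ (ℤ.+ zero) d _)  (ℚ.*<* (ℤ.+<+ ()))
  toℚ*inv-small κ (mkℚ ℤ.-[1+ n ] d _)  (ℚ.*<* ())
  toℚ*inv-small κ (mkℚ (ℤ.+ suc n) d _) _ = N , <-cross κ N (suc n) d κ/[1+N]≃ ℚᵘ.≃-refl (s≤s (ℕ.m≤m+n N (n ℕ.* suc N)))
    where
    N = κ ℕ.* suc d
    κ/[1+N]≃ : ℚ.toℚᵘ (toℚ κ * inv (suc N)) ℚᵘ.≃ mkℚᵘ (ℤ.+ κ) N
    κ/[1+N]≃ = ℚᵘ.≃-trans (ℚ.toℚᵘ-homo-* (toℚ κ) (inv (suc N))) (ℚᵘ.≃-trans (ℚᵘ.*-cong (toℚᵘ-toℚ/ κ 0) (toℚᵘ-toℚ/ 1 N))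
      (*≡* (trans (lemma (ℤ.+ κ) (ℤ.+ suc N)) (cong (λ z → ℤ.+ κ ℤ.* ℤ.+ suc z) (sym (ℕ.+-identityʳ N))))))
      where
      lemma : ∀ a b → (a ℤ.* ℤ.1ℤ) ℤ.* b ≡ a ℤ.* b
      lemma = ℤ-Solver.solve-∀

  *-mono-≤-nonNeg : ∀ {a b c d} → 0ℚ ≤ a → 0ℚ ≤ b → a ≤ c → b ≤ d → a * b ≤ c * d
  *-mono-≤-nonNeg {a} {b} {c} {d} 0≤a 0≤b a≤c b≤d = ℚ.≤-trans
    (ℚ.*-monoʳ-≤-nonNeg b {{ℚ.nonNegative 0≤b}} a≤c)
    (ℚ.*-monoˡ-≤-nonNeg c {{ℚ.nonNegative (ℚ.≤-trans 0≤a a≤c)}} b≤d)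

  0≤* : ∀ {a b} → 0ℚ ≤ a → 0ℚ ≤ b → 0ℚ ≤ a * b
  0≤* {a} {b} 0≤a 0≤b = subst (_≤ a * b) (ℚ.*-zeroˡ b) (ℚ.*-monoʳ-≤-nonNeg b {{ℚ.nonNegative 0≤b}} 0≤a)

  p≤q⇒0≤q-p : ∀ {p q} → p ≤ q → 0ℚ ≤ q - p
  p≤q⇒0≤q-p {p} {q} p≤q = subst (_≤ q - p) (ℚ.+-inverseʳ p) (ℚ.+-monoˡ-≤ (- p) p≤q)

  0≤q-p⇒p≤q : ∀ {p q} → 0ℚ ≤ q - p → p ≤ q
  0≤q-p⇒p≤q {p} {q} 0≤q-p = subst₂-≤ (ℚ.+-identityˡ p) (solve 2 (λ p q → (q :- p) :+ p := q) refl p q)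
    (ℚ.+-monoˡ-≤ p 0≤q-p)

  0≤q⇒p-q≤p : ∀ {p q} → 0ℚ ≤ q → p - q ≤ p
  0≤q⇒p-q≤p {p} {q} 0≤q = 0≤q-p⇒p≤q (subst (0ℚ ≤_) (solve 2 (λ p q → q := p :- (p :- q)) refl p q) 0≤q)

  p-q≤r⇒p-r≤q : ∀ {p q r} → p - q ≤ r → p - r ≤ q
  p-q≤r⇒p-r≤q {p} {q} {r} p-q≤r = 0≤q-p⇒p≤q (subst (0ℚ ≤_) (solve 3 (λ p q r → r :- (p :- q) := q :- (p :- r)) refl p q r)
    (p≤q⇒0≤q-p p-q≤r))

  0≤p⇒1-p≤1 : ∀ {p} → 0ℚ ≤ p → 1ℚ - p ≤ 1ℚ
  0≤p⇒1-p≤1 = 0≤q⇒p-q≤p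

  _∈[0,1] : ℚ → Set
  p ∈[0,1] = 0ℚ ≤ p × p ≤ 1ℚ

  1∈[0,1] : 1ℚ ∈[0,1]
  1∈[0,1] = 0≤inv 1 , ℚ.≤-refl

  1-p∈[0,1] : ∀ {p} → p ∈[0,1] → (1ℚ - p) ∈[0,1]
  1-p∈[0,1] (0≤p , p≤1) = p≤q⇒0≤q-p p≤1 , 0≤p⇒1-p≤1 0≤p

  *-∈[0,1] : ∀ {p q} → p ∈[0,1] → q ∈[0,1] → (p * q) ∈[0,1]
  *-∈[0,1] (0≤p , p≤1) (0≤q , q≤1) = 0≤* 0≤p 0≤q , *-mono-≤-nonNeg 0≤p 0≤q p≤1 q≤1

  powℚ-∈[0,1] : ∀ {p} n → p ∈[0,1] → powℚ p n ∈[0,1]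
  powℚ-∈[0,1] zero    p∈ = 1∈[0,1]
  powℚ-∈[0,1] (suc n) p∈ = *-∈[0,1] p∈ (powℚ-∈[0,1] n p∈)

  ∣u-v∣≤U-L : ∀ {u v L U} → L ≤ u → u ≤ U → L ≤ v → v ≤ U → ∣ u - v ∣ ≤ U - L
  ∣u-v∣≤U-L {u} {v} {L} {U} L≤u u≤U L≤v v≤U with ℚ.∣p∣≡p∨∣p∣≡-p (u - v)
  ... | inj₁ eq = subst (_≤ U - L) (sym eq) (ℚ.+-mono-≤ u≤U (ℚ.neg-antimono-≤ L≤v))
  ... | inj₂ eq = subst (_≤ U - L) (trans (solve 2 (λ u v → v :- u := :- (u :- v)) refl u v) (sym eq))
    (ℚ.+-mono-≤ v≤U (ℚ.neg-antimono-≤ L≤u))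

  -- SumsTo f q unfolds to Tendsto (λ n → sumℚ n f) q.
  Tendsto : (ℕ → ℚ) → ℚ → Set
  Tendsto s L = ∀ ε → 0ℚ < ε → ∃[ N ] (∀ n → N ℕ.≤ n → ∣ s n - L ∣ < ε)

  private
    0<½* : ∀ {ε} → 0ℚ < ε → 0ℚ < ½ * ε
    0<½* {ε} 0<ε = ℚ.positive⁻¹ (½ * ε) {{ℚ.pos*pos⇒pos ½ ε {{ℚ.positive 0<ε}}}}

    ½*+½*≡ : ∀ ε → ½ * ε + ½ * ε ≡ ε
    ½*+½*≡ = solve 1 (λ e → con ½ :* e :+ con ½ :* e := e) refl

  tendsto-unique : ∀ {s a b} → Tendsto s a → Tendsto s b → a ≡ b
  tendsto-unique {s} {a} {b} s→a s→b with a ℚ.≟ b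
  ... | yes a≡b = a≡b
  ... | no  a≢b = ⊥-elim (ℚ.<-irrefl refl d<d)
    where
    d = ∣ a - b ∣
    0<d : 0ℚ < d
    0<d with ℚ.<-cmp 0ℚ d
    ... | tri< 0<d _ _ = 0<d
    ... | tri≈ _ 0≡d _ = ⊥-elim (a≢b (begin
      a              ≡⟨ solve 2 (λ a b → a := (a :- b) :+ b) refl a b ⟩
      (a - b) + b    ≡⟨ cong (_+ b) (ℚ.∣p∣≡0⇒p≡0 (a - b) (sym 0≡d)) ⟩
      0ℚ + b         ≡⟨ ℚ.+-identityˡ b ⟩
      b              ∎))
      where open ≡-Reasoning
    ... | tri> _ _ d<0 = ⊥-elim (ℚ.<-irrefl refl (ℚ.<-≤-trans d<0 (ℚ.0≤∣p∣ (a - b))))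
    N₁ = proj₁ (s→a (½ * d) (0<½* 0<d))
    N₂ = proj₁ (s→b (½ * d) (0<½* 0<d))
    n = N₁ ℕ.⊔ N₂
    d<d : d < d
    d<d = begin-strict
      ∣ a - b ∣                      ≡⟨ cong ∣_∣ (solve 3 (λ a b x → a :- b := (x :- b) :- (x :- a)) refl a b (s n)) ⟩
      ∣ (s n - b) - (s n - a) ∣      ≤⟨ ℚ.∣p-q∣≤∣p∣+∣q∣ (s n - b) (s n - a) ⟩
      ∣ s n - b ∣ + ∣ s n - a ∣      <⟨ ℚ.+-mono-< (proj₂ (s→b (½ * d) (0<½* 0<d)) n (ℕ.m≤n⊔m N₁ N₂))
                                                     (proj₂ (s→a (½ * d) (0<½* 0<d)) n (ℕ.m≤m⊔n N₁ N₂)) ⟩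
      ½ * d + ½ * d                  ≡⟨ ½*+½*≡ d ⟩
      d                              ∎
      where open ℚ.≤-Reasoning

  tendsto-cong : ∀ {s t L} → (∀ n → s n ≡ t n) → Tendsto s L → Tendsto t L
  tendsto-cong {L = L} s≡t s→L ε 0<ε with s→L ε 0<ε
  ... | N , close = N , λ n N≤n → subst (λ z → ∣ z - L ∣ < ε) (s≡t n) (close n N≤n)

  tendsto-suc : ∀ {s L} → Tendsto s L → Tendsto (λ n → s (suc n)) L
  tendsto-suc s→L ε 0<ε with s→L ε 0<ε
  ... | N , close = N , λ n N≤n → close (suc n) (ℕ.m≤n⇒m≤1+n N≤n)

  tendsto-+ : ∀ {s t a b} → Tendsto s a → Tendsto t b → Tendsto (λ n → s n + t n) (a + b)
  tendsto-+ {s} {t} {a} {b} s→a t→b ε 0<ε with s→a (½ * ε) (0<½* 0<ε) | t→b (½ * ε) (0<½* 0<ε)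
  ... | N₁ , close₁ | N₂ , close₂ = N₁ ℕ.⊔ N₂ , λ n N≤n → begin-strict
    ∣ (s n + t n) - (a + b) ∣    ≡⟨ cong ∣_∣ (solve 4 (λ x y a b → (x :+ y) :- (a :+ b) := (x :- a) :+ (y :- b)) refl (s n) (t n) a b) ⟩
    ∣ (s n - a) + (t n - b) ∣    ≤⟨ ℚ.∣p+q∣≤∣p∣+∣q∣ (s n - a) (t n - b) ⟩
    ∣ s n - a ∣ + ∣ t n - b ∣    <⟨ ℚ.+-mono-< (close₁ n (ℕ.≤-trans (ℕ.m≤m⊔n N₁ N₂) N≤n))
                                                (close₂ n (ℕ.≤-trans (ℕ.m≤n⊔m N₁ N₂) N≤n)) ⟩
    ½ * ε + ½ * ε                ≡⟨ ½*+½*≡ ε ⟩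
    ε                            ∎
    where open ℚ.≤-Reasoning

  tendsto-*ˡ : ∀ {s a} c → ∣ c ∣ ≤ 1ℚ → Tendsto s a → Tendsto (λ n → c * s n) (c * a)
  tendsto-*ˡ {s} {a} c ∣c∣≤1 s→a ε 0<ε with s→a ε 0<ε
  ... | N , close = N , λ n N≤n → begin-strict
    ∣ c * s n - c * a ∣        ≡⟨ cong ∣_∣ (solve 3 (λ c x a → c :* x :- c :* a := c :* (x :- a)) refl c (s n) a) ⟩
    ∣ c * (s n - a) ∣          ≡⟨ ℚ.∣p*q∣≡∣p∣*∣q∣ c (s n - a) ⟩
    ∣ c ∣ * ∣ s n - a ∣        ≤⟨ ℚ.*-monoʳ-≤-nonNeg ∣ s n - a ∣ {{ℚ.∣-∣-nonNeg (s n - a)}} ∣c∣≤1 ⟩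
    1ℚ * ∣ s n - a ∣           ≡⟨ ℚ.*-identityˡ _ ⟩
    ∣ s n - a ∣                <⟨ close n N≤n ⟩
    ε                          ∎
    where open ℚ.≤-Reasoning

  tendsto-eventually-const : ∀ {s L} N → (∀ n → N ℕ.≤ n → s n ≡ L) → Tendsto s L
  tendsto-eventually-const {L = L} N s≡L ε 0<ε = N , λ n N≤n →
    subst (_< ε) (sym (trans (cong (λ z → ∣ z - L ∣) (s≡L n N≤n)) (cong ∣_∣ (ℚ.+-inverseʳ L)))) 0<ε

  cauchy-cong : ∀ {s t} → (∀ n → s n ≡ t n) → Cauchy s → Cauchy t
  cauchy-cong s≡t s-cauchy ε 0<ε with s-cauchy ε 0<ε
  ... | N , close = N , λ m n N≤m N≤n → subst (_< ε) (cong₂ (λ u v → ∣ u - v ∣) (s≡t m) (s≡t n)) (close m n N≤m N≤n)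

  cauchy-suc : ∀ {s} → Cauchy s → Cauchy (λ n → s (suc n))
  cauchy-suc s-cauchy ε 0<ε with s-cauchy ε 0<ε
  ... | N , close = N , λ m n N≤m N≤n → close (suc m) (suc n) (ℕ.m≤n⇒m≤1+n N≤m) (ℕ.m≤n⇒m≤1+n N≤n)

  private
    sameLimit-≡ : ∀ {s t} → (∀ n → s n ≡ t n) → SameLimit s t
    sameLimit-≡ {s} s≡t ε 0<ε = 0 , λ n _ →
      subst (_< ε) (sym (trans (cong (λ z → ∣ s n - z ∣) (sym (s≡t n))) (cong ∣_∣ (ℚ.+-inverseʳ (s n))))) 0<ε

  sumℚ-cong : ∀ n {f g} → (∀ t → t ℕ.< n → f t ≡ g t) → sumℚ n f ≡ sumℚ n g
  sumℚ-cong zero    f≡g = refl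
  sumℚ-cong (suc n) f≡g = cong₂ _+_ (sumℚ-cong n (λ t t<n → f≡g t (ℕ.m<n⇒m<1+n t<n))) (f≡g n ℕ.≤-refl)

  sumℚ-+ : ∀ n f g → sumℚ n (λ t → f t + g t) ≡ sumℚ n f + sumℚ n g
  sumℚ-+ zero    f g = sym (ℚ.+-identityˡ 0ℚ)
  sumℚ-+ (suc n) f g = trans (cong (_+ (f n + g n)) (sumℚ-+ n f g))
    (+-interchange (sumℚ n f) (sumℚ n g) (f n) (g n))

  sumℚ-unfoldˡ : ∀ n f → sumℚ (suc n) f ≡ f 0 + sumℚ n (λ t → f (suc t))
  sumℚ-unfoldˡ zero    f = trans (ℚ.+-identityˡ (f 0)) (sym (ℚ.+-identityʳ (f 0)))
  sumℚ-unfoldˡ (suc n) f = trans (cong (_+ f (suc n)) (sumℚ-unfoldˡ n f)) (ℚ.+-assoc (f 0) _ _)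

  sumℚ-zero : ∀ n f → (∀ t → t ℕ.< n → f t ≡ 0ℚ) → sumℚ n f ≡ 0ℚ
  sumℚ-zero n f f≡0 = trans (sumℚ-cong n f≡0) (sumℚ-const-0 n)
    where
    sumℚ-const-0 : ∀ n → sumℚ n (λ _ → 0ℚ) ≡ 0ℚ
    sumℚ-const-0 zero    = refl
    sumℚ-const-0 (suc n) = cong (_+ 0ℚ) (sumℚ-const-0 n)

  sumℚ-extend : ∀ n k f → (∀ t → n ℕ.≤ t → f t ≡ 0ℚ) → sumℚ (k ℕ.+ n) f ≡ sumℚ n f
  sumℚ-extend n zero    f f≡0 = refl
  sumℚ-extend n (suc k) f f≡0 = trans (cong₂ _+_ (sumℚ-extend n k f f≡0) (f≡0 (k ℕ.+ n) (ℕ.m≤n+m n k)))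
    (ℚ.+-identityʳ _)

  onPoint : ℕ → (ℕ → ℚ) → ℕ → ℚ
  onPoint N f d = if does (d ℕ.≟ N) then f d else 0ℚ

  onPoint-≡ : ∀ {N d} f → d ≡ N → onPoint N f d ≡ f d
  onPoint-≡ {N} {d} f d≡N = cong (if_then f d else 0ℚ) (dec-true (d ℕ.≟ N) d≡N)

  onPoint-≢ : ∀ {N d} f → d ≢ N → onPoint N f d ≡ 0ℚ
  onPoint-≢ {N} {d} f d≢N = cong (if_then f d else 0ℚ) (dec-false (d ℕ.≟ N) d≢N)

  sumℚ-onPoint : ∀ n f → sumℚ (suc n) (onPoint n f) ≡ f n
  sumℚ-onPoint n f = begin
    sumℚ n (onPoint n f) + onPoint n f n
      ≡⟨ cong₂ _+_ (sumℚ-zero n (onPoint n f) (λ t t<n → onPoint-≢ f (ℕ.<⇒≢ t<n))) (onPoint-≡ f refl) ⟩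
    0ℚ + f n ≡⟨ ℚ.+-identityˡ (f n) ⟩
    f n      ∎
    where open ≡-Reasoning

  onDivisors : ℕ → (ℕ → ℚ) → ℕ → ℚ
  onDivisors N f d = if does (d ∣? N) then f d else 0ℚ

  sumDivisors≡sumℚ-onDivisors : ∀ N f → sumDivisors N f ≡ sumℚ (suc N) (onDivisors N f)
  sumDivisors≡sumℚ-onDivisors N f = go (suc N)
    where
    open ≡-Reasoning
    listSum = List.foldr _+_ 0ℚ
    listSum-++ : ∀ xs ys → listSum (xs ++ ys) ≡ listSum xs + listSum ys
    listSum-++ []       ys = sym (ℚ.+-identityˡ _)
    listSum-++ (x ∷ xs) ys = trans (cong (x +_) (listSum-++ xs ys)) (sym (ℚ.+-assoc x _ _))
    go : ∀ M → listSum (map f (filter (_∣? N) (upTo M))) ≡ sumℚ M (onDivisors N f)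
    go zero    = refl
    go (suc M) = begin
      listSum (map f (filter (_∣? N) (upTo (suc M))))
        ≡⟨ cong (λ xs → listSum (map f (filter (_∣? N) xs))) (sym (List.upTo-∷ʳ M)) ⟩
      listSum (map f (filter (_∣? N) (upTo M ++ [ M ])))
        ≡⟨ cong (λ xs → listSum (map f xs)) (List.filter-++ (_∣? N) (upTo M) [ M ]) ⟩
      listSum (map f (filter (_∣? N) (upTo M) ++ filter (_∣? N) [ M ]))
        ≡⟨ cong listSum (List.map-++ f (filter (_∣? N) (upTo M)) _) ⟩
      listSum (map f (filter (_∣? N) (upTo M)) ++ map f (filter (_∣? N) [ M ]))
        ≡⟨ listSum-++ (map f (filter (_∣? N) (upTo M))) _ ⟩
      listSum (map f (filter (_∣? N) (upTo M))) + listSum (map f (filter (_∣? N) [ M ]))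
        ≡⟨ cong₂ _+_ (go M) last ⟩
      sumℚ M (onDivisors N f) + onDivisors N f M ∎
      where
      last : listSum (map f (filter (_∣? N) [ M ])) ≡ onDivisors N f M
      last with M ∣? N
      ... | yes _ = ℚ.+-identityʳ (f M)
      ... | no  _ = refl

  powℚ-[k+ℓ]∸2 : ∀ x k ℓ → powℚ x ((suc k ℕ.+ suc ℓ) ∸ 2) ≡ powℚ x k * powℚ x ℓ
  powℚ-[k+ℓ]∸2 x k ℓ = trans (cong (λ n → powℚ x (n ∸ 1)) (ℕ.+-suc k ℓ)) (powℚ-+ x k ℓ)

  Cfactor≡Dp : ∀ k ℓ p → Cfactor (suc k) (suc ℓ) p ≡ Dp (suc k) (suc ℓ) p
  Cfactor≡Dp k ℓ p = begin
    1ℚ - (1ℚ - powℚ x k) * (1ℚ - powℚ x ℓ)   ≡⟨ solve 2 (λ X Y → con 1ℚ :- (con 1ℚ :- X) :* (con 1ℚ :- Y) := (X :+ Y) :- X :* Y) refl (powℚ x k) (powℚ x ℓ) ⟩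
    (powℚ x k + powℚ x ℓ) - powℚ x k * powℚ x ℓ ≡⟨ cong (λ z → (powℚ x k + powℚ x ℓ) - z) (powℚ-[k+ℓ]∸2 x k ℓ) ⟨
    Dp (suc k) (suc ℓ) p ∎
    where
    open ≡-Reasoning
    x = oneMinusInv p

  -- Used with P = p, y = 1/p, A j = A_{k,ℓ}(p^j) and B j = σ_{k-1}(p^j,1) σ_{ℓ-1}(p^j,1).
  module Telescoping (P y : ℚ) (y*P≡1 : y * P ≡ 1ℚ) (A B : ℕ → ℚ) (B₀≡1 : B 0 ≡ 1ℚ) (A≡B : ∀ j → A (suc j) ≡ B (suc j)) where

    private
      P^*y^≡1 : ∀ n → powℚ P n * powℚ y n ≡ 1ℚ
      P^*y^≡1 n = trans (sym (powℚ-* P y n)) (trans (cong (λ z → powℚ z n) (trans (ℚ.*-comm P y) y*P≡1)) (powℚ-1 n))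

      P^*y^+ : ∀ m n z → powℚ P m * (z * powℚ y (m ℕ.+ n)) ≡ z * powℚ y n
      P^*y^+ m n z = begin
        powℚ P m * (z * powℚ y (m ℕ.+ n))            ≡⟨ cong (λ w → powℚ P m * (z * w)) (powℚ-+ y m n) ⟩
        powℚ P m * (z * (powℚ y m * powℚ y n))       ≡⟨ solve 4 (λ a z b c → a :* (z :* (b :* c)) := z :* ((a :* b) :* c)) refl (powℚ P m) z (powℚ y m) (powℚ y n) ⟩
        z * ((powℚ P m * powℚ y m) * powℚ y n)       ≡⟨ cong (λ w → z * (w * powℚ y n)) (P^*y^≡1 m) ⟩
        z * (1ℚ * powℚ y n)                          ≡⟨ cong (z *_) (ℚ.*-identityˡ _) ⟩
        z * powℚ y n                                 ∎
        where open ≡-Reasoning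

      boundaryTerm : ∀ a z → powℚ P a * (z * powℚ y (2 ℕ.* suc a)) ≡ z * powℚ y (suc (suc a))
      boundaryTerm a z = trans (cong (λ n → powℚ P a * (z * powℚ y n)) (2[1+a]≡a+2+a a)) (P^*y^+ a (suc (suc a)) z)
        where
        2[1+a]≡a+2+a : ∀ a → 2 ℕ.* suc a ≡ a ℕ.+ suc (suc a)
        2[1+a]≡a+2+a = ℕ-Solver.solve-∀

      innerTerm : ∀ i z → (powℚ P (suc i) - powℚ P i) * (z * powℚ y (2 ℕ.* suc i))
                          ≡ z * (powℚ y (suc i) - powℚ y (suc (suc i)))
      innerTerm i z = begin
        (powℚ P (suc i) - powℚ P i) * w
          ≡⟨ solve 3 (λ a b c → (a :- b) :* c := a :* c :- b :* c) refl (powℚ P (suc i)) (powℚ P i) w ⟩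
        powℚ P (suc i) * w - powℚ P i * w
          ≡⟨ cong₂ _-_ (trans (cong (λ n → powℚ P (suc i) * (z * powℚ y n)) (2[1+i]≡[1+i]+[1+i] i)) (P^*y^+ (suc i) (suc i) z))
                       (boundaryTerm i z) ⟩
        z * powℚ y (suc i) - z * powℚ y (suc (suc i))
          ≡⟨ solve 3 (λ z a b → z :* a :- z :* b := z :* (a :- b)) refl z (powℚ y (suc i)) (powℚ y (suc (suc i))) ⟩
        z * (powℚ y (suc i) - powℚ y (suc (suc i))) ∎
        where
        open ≡-Reasoning
        w = z * powℚ y (2 ℕ.* suc i)
        2[1+i]≡[1+i]+[1+i] : ∀ i → 2 ℕ.* suc i ≡ suc i ℕ.+ suc i
        2[1+i]≡[1+i]+[1+i] = ℕ-Solver.solve-∀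

      lhs : ℕ → ℚ
      lhs j = B j * powℚ y j - B (suc j) * powℚ y (suc (suc j))

      rhs : ℕ → ℚ
      rhs a = (1ℚ + sumℚ a (λ i → A (suc i) * (powℚ y (suc i) - powℚ y (suc (suc i))))) - A (suc a) * powℚ y (suc (suc a))

      sum-lhs≡rhs : ∀ a → sumℚ (suc a) lhs ≡ rhs a
      sum-lhs≡rhs zero = begin
        0ℚ + (B 0 * 1ℚ - B 1 * powℚ y 2)   ≡⟨ cong₂ (λ u v → 0ℚ + (u * 1ℚ - v * powℚ y 2)) B₀≡1 (sym (A≡B 0)) ⟩
        0ℚ + (1ℚ * 1ℚ - A 1 * powℚ y 2)    ≡⟨ solve 2 (λ a w → con 0ℚ :+ (con 1ℚ :* con 1ℚ :- a :* w) := (con 1ℚ :+ con 0ℚ) :- a :* w) refl (A 1) (powℚ y 2) ⟩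
        (1ℚ + 0ℚ) - A 1 * powℚ y 2         ∎
        where open ≡-Reasoning
      sum-lhs≡rhs (suc a) = begin
        sumℚ (suc a) lhs + lhs (suc a)
          ≡⟨ cong₂ _+_ (sum-lhs≡rhs a) (cong₂ (λ u v → u * w - v * (y * (y * w))) (sym (A≡B a)) (sym (A≡B (suc a)))) ⟩
        rhs a + (A₁ * w - A₂ * (y * (y * w)))
          ≡⟨ solve 5 (λ Σ a₁ a₂ w y → ((con 1ℚ :+ Σ) :- a₁ :* (y :* w)) :+ (a₁ :* w :- a₂ :* (y :* (y :* w)))
                                       := (con 1ℚ :+ (Σ :+ a₁ :* (w :- y :* w))) :- a₂ :* (y :* (y :* w))) refl Σₐ A₁ A₂ w y ⟩
        rhs (suc a) ∎
        where
        open ≡-Reasoning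
        w = powℚ y (suc a)
        A₁ = A (suc a)
        A₂ = A (suc (suc a))
        Σₐ = sumℚ a (λ i → A (suc i) * (powℚ y (suc i) - powℚ y (suc (suc i))))

    telescoping : ∀ a → sumℚ (suc a) (λ j → B j * powℚ y j - B (suc j) * powℚ y (j ℕ.+ 2))
                        ≡ (1ℚ + sumℚ a (λ i → (powℚ P (suc i) - powℚ P i) * (A (suc i) * powℚ y (2 ℕ.* suc i))))
                          - powℚ P a * (A (suc a) * powℚ y (2 ℕ.* suc a))
    telescoping a = begin
      sumℚ (suc a) (λ j → B j * powℚ y j - B (suc j) * powℚ y (j ℕ.+ 2))
        ≡⟨ sumℚ-cong (suc a) (λ j _ → cong (λ n → B j * powℚ y j - B (suc j) * powℚ y n) (ℕ.+-comm j 2)) ⟩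
      sumℚ (suc a) lhs
        ≡⟨ sum-lhs≡rhs a ⟩
      rhs a
        ≡⟨ cong₂ (λ u v → (1ℚ + u) - v) (sumℚ-cong a (λ i _ → innerTerm i (A (suc i)))) (boundaryTerm a (A (suc a))) ⟨
      (1ℚ + sumℚ a (λ i → (powℚ P (suc i) - powℚ P i) * (A (suc i) * powℚ y (2 ℕ.* suc i))))
        - powℚ P a * (A (suc a) * powℚ y (2 ℕ.* suc a)) ∎
      where open ≡-Reasoning

  -- The division by d inside Defs' τ, which is local there.
  quotient : ℕ → ℕ → ℕ
  quotient N zero    = 0
  quotient N (suc d) = N / suc d

  τ-suc : ∀ m N → τ (suc m) (suc N) ≡ sumℚ (suc (suc N)) (onDivisors (suc N) (λ d → τ m (quotient (suc N) d)))
  τ-suc m N = trans (sumDivisors≡sumℚ-onDivisors (suc N) _)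
    (sumℚ-cong (suc (suc N)) (λ { zero _ → refl ; (suc d) _ → refl }))

  τ-1 : ∀ m → τ m 1 ≡ 1ℚ
  τ-1 zero    = refl
  τ-1 (suc m) = trans (ℚ.+-identityʳ _) (τ-1 m)

  τ₀-≢1 : ∀ N → N ≢ 1 → τ 0 N ≡ 0ℚ
  τ₀-≢1 N N≢1 with N ℕ.≟ 1
  ... | yes N≡1 = ⊥-elim (N≢1 N≡1)
  ... | no  _   = refl

  module PrimePower (q : ℕ) (p-prime : Prime (suc (suc q))) where

    p : ℕ
    p = suc (suc q)

    p^≢0 : ∀ n → NonZero (p ^ n)
    p^≢0 n = ℕ.m^n≢0 p n

    p^<p^suc : ∀ n → p ^ n ℕ.< p ^ suc n
    p^<p^suc n = ℕ.^-monoʳ-< p (s≤s (s≤s z≤n)) (ℕ.n<1+n n)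

    p^≡p^∸*p^ : ∀ {t n} → t ℕ.≤ n → p ^ n ≡ p ^ (n ∸ t) ℕ.* p ^ t
    p^≡p^∸*p^ {t} {n} t≤n = begin
      p ^ n                  ≡⟨ cong (p ^_) (ℕ.m+[n∸m]≡n t≤n) ⟨
      p ^ (t ℕ.+ (n ∸ t))    ≡⟨ ℕ.^-distribˡ-+-* p t (n ∸ t) ⟩
      p ^ t ℕ.* p ^ (n ∸ t)  ≡⟨ ℕ.*-comm (p ^ t) _ ⟩
      p ^ (n ∸ t) ℕ.* p ^ t  ∎
      where open ≡-Reasoning

    p^∣p^ : ∀ {t n} → t ℕ.≤ n → p ^ t ∣ p ^ n
    p^∣p^ {t} {n} t≤n = divides (p ^ (n ∸ t)) (p^≡p^∸*p^ t≤n)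

    ∣p^⇒≡p^ : ∀ n d → d ∣ p ^ n → ∃[ t ] t ℕ.≤ n × d ≡ p ^ t
    ∣p^⇒≡p^ zero    d d∣1 = 0 , z≤n , ∣1⇒≡1 d∣1
    ∣p^⇒≡p^ (suc n) d d∣p^suc with p ∣? d
    ... | yes (divides c d≡c*p) with ∣p^⇒≡p^ n c (*-cancelˡ-∣ p (subst (_∣ p ^ suc n) (trans d≡c*p (ℕ.*-comm c p)) d∣p^suc))
    ...   | t , t≤n , c≡p^t = suc t , s≤s t≤n , trans d≡c*p (trans (cong (ℕ._* p) c≡p^t) (ℕ.*-comm (p ^ t) p))
    ∣p^⇒≡p^ (suc n) d d∣p^suc | no p∤d with ∣p^⇒≡p^ n d (coprime-divisor d⊥p d∣p^suc)
      where
      d⊥p : Coprime d p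
      d⊥p (i∣d , i∣p) with prime⇒irreducible p-prime i∣p
      ... | inj₁ i≡1 = i≡1
      ... | inj₂ i≡p = ⊥-elim (p∤d (subst (_∣ d) i≡p i∣d))
    ... | t , t≤n , d≡p^t = t , ℕ.m≤n⇒m≤1+n t≤n , d≡p^t

    ∣p^suc∧≢⇒∣p^ : ∀ n d → d ∣ p ^ suc n → d ≢ p ^ suc n → d ∣ p ^ n
    ∣p^suc∧≢⇒∣p^ n d d∣ d≢ with ∣p^⇒≡p^ (suc n) d d∣
    ... | t , t≤1+n , refl with ℕ.m≤n⇒m<n∨m≡n t≤1+n
    ...   | inj₁ (s≤s t≤n) = p^∣p^ t≤n
    ...   | inj₂ t≡1+n     = ⊥-elim (d≢ (cong (p ^_) t≡1+n))

    onDivisors-p^suc : ∀ n f d → onDivisors (p ^ suc n) f d ≡ onDivisors (p ^ n) f d + onPoint (p ^ suc n) f d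
    onDivisors-p^suc n f d with d ∣? p ^ suc n | d ∣? p ^ n | d ℕ.≟ p ^ suc n
    ... | yes _   | yes d∣p^n | yes refl = ⊥-elim (ℕ.<⇒≱ (p^<p^suc n) (∣⇒≤ {{p^≢0 n}} d∣p^n))
    ... | yes _   | yes _     | no  d≢   = sym (trans (cong (f d +_) (onPoint-≢ f d≢)) (ℚ.+-identityʳ (f d)))
    ... | yes _   | no  _     | yes d≡   = sym (trans (cong (0ℚ +_) (onPoint-≡ f d≡)) (ℚ.+-identityˡ (f d)))
    ... | yes d∣  | no  d∤    | no  d≢   = ⊥-elim (d∤ (∣p^suc∧≢⇒∣p^ n d d∣ d≢))
    ... | no  d∤  | yes d∣    | _        = ⊥-elim (d∤ (∣-trans d∣ (n∣m*n p)))
    ... | no  d∤  | no  _     | yes refl = ⊥-elim (d∤ ∣-refl)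
    ... | no  _   | no  _     | no  d≢   = sym (trans (cong (0ℚ +_) (onPoint-≢ f d≢)) (ℚ.+-identityˡ 0ℚ))

    sumℚ-onDivisors-p^ : ∀ n f → sumℚ (suc (p ^ n)) (onDivisors (p ^ n) f) ≡ sumℚ (suc n) (λ t → f (p ^ t))
    sumℚ-onDivisors-p^ zero    f = refl
    sumℚ-onDivisors-p^ (suc n) f = begin
      sumℚ (suc (p ^ suc n)) (onDivisors (p ^ suc n) f)
        ≡⟨ sumℚ-cong (suc (p ^ suc n)) (λ d _ → onDivisors-p^suc n f d) ⟩
      sumℚ (suc (p ^ suc n)) (λ d → onDivisors (p ^ n) f d + onPoint (p ^ suc n) f d)
        ≡⟨ sumℚ-+ (suc (p ^ suc n)) (onDivisors (p ^ n) f) (onPoint (p ^ suc n) f) ⟩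
      sumℚ (suc (p ^ suc n)) (onDivisors (p ^ n) f) + sumℚ (suc (p ^ suc n)) (onPoint (p ^ suc n) f)
        ≡⟨ cong₂ _+_ shrink (sumℚ-onPoint (p ^ suc n) f) ⟩
      sumℚ (suc (p ^ n)) (onDivisors (p ^ n) f) + f (p ^ suc n)
        ≡⟨ cong (_+ f (p ^ suc n)) (sumℚ-onDivisors-p^ n f) ⟩
      sumℚ (suc n) (λ t → f (p ^ t)) + f (p ^ suc n) ∎
      where
      open ≡-Reasoning
      vanish : ∀ d → suc (p ^ n) ℕ.≤ d → onDivisors (p ^ n) f d ≡ 0ℚ
      vanish d p^n<d with d ∣? p ^ n
      ... | yes d∣ = ⊥-elim (ℕ.<⇒≱ p^n<d (∣⇒≤ {{p^≢0 n}} d∣))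
      ... | no  _  = refl
      shrink : sumℚ (suc (p ^ suc n)) (onDivisors (p ^ n) f) ≡ sumℚ (suc (p ^ n)) (onDivisors (p ^ n) f)
      shrink = trans (cong (λ m → sumℚ m (onDivisors (p ^ n) f)) (sym (ℕ.m∸n+n≡m (s≤s (ℕ.<⇒≤ (p^<p^suc n))))))
                     (sumℚ-extend (suc (p ^ n)) (p ^ suc n ∸ p ^ n) (onDivisors (p ^ n) f) vanish)

    quotient-p^ : ∀ {t n} → t ℕ.≤ n → quotient (p ^ n) (p ^ t) ≡ p ^ (n ∸ t)
    quotient-p^ {t} {n} t≤n with suc^≡suc (suc q) t
    ... | r , p^t≡1+r = begin
      quotient (p ^ n) (p ^ t)          ≡⟨ cong (quotient (p ^ n)) p^t≡1+r ⟩
      p ^ n / suc r                     ≡⟨ cong (_/ suc r) (trans (p^≡p^∸*p^ t≤n) (cong (p ^ (n ∸ t) ℕ.*_) p^t≡1+r)) ⟩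
      (p ^ (n ∸ t) ℕ.* suc r) / suc r   ≡⟨ m*n/n≡m (p ^ (n ∸ t)) (suc r) ⟩
      p ^ (n ∸ t)                       ∎
      where open ≡-Reasoning

    τ-suc-p^ : ∀ m n → τ (suc m) (p ^ n) ≡ sumℚ (suc n) (λ t → τ m (p ^ (n ∸ t)))
    τ-suc-p^ m n with suc^≡suc (suc q) n
    ... | N , p^n≡1+N = begin
      τ (suc m) (p ^ n)
        ≡⟨ cong (τ (suc m)) p^n≡1+N ⟩
      τ (suc m) (suc N)
        ≡⟨ τ-suc m N ⟩
      sumℚ (suc (suc N)) (onDivisors (suc N) (λ d → τ m (quotient (suc N) d)))
        ≡⟨ cong (λ M → sumℚ (suc M) (onDivisors M (λ d → τ m (quotient M d)))) p^n≡1+N ⟨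
      sumℚ (suc (p ^ n)) (onDivisors (p ^ n) (λ d → τ m (quotient (p ^ n) d)))
        ≡⟨ sumℚ-onDivisors-p^ n _ ⟩
      sumℚ (suc n) (λ t → τ m (quotient (p ^ n) (p ^ t)))
        ≡⟨ sumℚ-cong (suc n) (λ t t<1+n → cong (τ m) (quotient-p^ (ℕ.≤-pred t<1+n))) ⟩
      sumℚ (suc n) (λ t → τ m (p ^ (n ∸ t))) ∎
      where open ≡-Reasoning

    τ-suc-p^suc : ∀ m n → τ (suc m) (p ^ suc n) ≡ τ (suc m) (p ^ n) + τ m (p ^ suc n)
    τ-suc-p^suc m n = begin
      τ (suc m) (p ^ suc n)                                       ≡⟨ τ-suc-p^ m (suc n) ⟩
      sumℚ (suc (suc n)) (λ t → τ m (p ^ (suc n ∸ t)))             ≡⟨ sumℚ-unfoldˡ (suc n) _ ⟩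
      τ m (p ^ suc n) + sumℚ (suc n) (λ t → τ m (p ^ (n ∸ t)))     ≡⟨ cong (τ m (p ^ suc n) +_) (τ-suc-p^ m n) ⟨
      τ m (p ^ suc n) + τ (suc m) (p ^ n)                         ≡⟨ ℚ.+-comm (τ m (p ^ suc n)) _ ⟩
      τ (suc m) (p ^ n) + τ m (p ^ suc n)                         ∎
      where open ≡-Reasoning

    τ₀-p^suc : ∀ n → τ 0 (p ^ suc n) ≡ 0ℚ
    τ₀-p^suc n = τ₀-≢1 (p ^ suc n) p^suc≢1
      where
      p^suc≢1 : p ^ suc n ≢ 1
      p^suc≢1 p^suc≡1 with ℕ.m^n≡1⇒n≡0∨m≡1 p (suc n) p^suc≡1
      ... | inj₁ ()
      ... | inj₂ ()

    τ-suc-p^≡C : ∀ k α → τ (suc k) (p ^ α) ≡ toℚ ((k ℕ.+ α) C k)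
    τ-suc-p^≡C zero    zero    = refl
    τ-suc-p^≡C zero    (suc α) = trans (τ-suc-p^suc 0 α) (cong₂ _+_ (τ-suc-p^≡C zero α) (τ₀-p^suc α))
    τ-suc-p^≡C (suc k) zero    = trans (τ-1 (suc (suc k)))
      (cong toℚ (sym (trans (cong (_C suc k) (ℕ.+-identityʳ (suc k))) (nCn≡1 (suc k)))))
    τ-suc-p^≡C (suc k) (suc α) = begin
      τ (suc (suc k)) (p ^ suc α)                                ≡⟨ τ-suc-p^suc (suc k) α ⟩
      τ (suc (suc k)) (p ^ α) + τ (suc k) (p ^ suc α)            ≡⟨ cong₂ _+_ (τ-suc-p^≡C (suc k) α) (τ-suc-p^≡C k (suc α)) ⟩
      toℚ ((suc k ℕ.+ α) C suc k) + toℚ ((k ℕ.+ suc α) C k)      ≡⟨ cong (λ n → toℚ (n C suc k) + toℚ ((k ℕ.+ suc α) C k)) (ℕ.+-suc k α) ⟨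
      toℚ (n C suc k) + toℚ (n C k)                              ≡⟨ ℚ.+-comm (toℚ (n C suc k)) _ ⟩
      toℚ (n C k) + toℚ (n C suc k)                              ≡⟨ toℚ-+ (n C k) (n C suc k) ⟨
      toℚ (n C k ℕ.+ n C suc k)                                  ≡⟨ cong toℚ (nCk+nC[k+1]≡[n+1]C[k+1] n k) ⟩
      toℚ ((suc k ℕ.+ suc α) C suc k)                            ∎
      where
      open ≡-Reasoning
      n = k ℕ.+ suc α

    y : ℚ
    y = inv p

    inv-p^ : ∀ n → inv (p ^ n) ≡ powℚ y n
    inv-p^ = inv-^ (suc q)

    ∣y∣≤1 : ∣ y ∣ ≤ 1ℚ
    ∣y∣≤1 = subst (_≤ 1ℚ) (sym (ℚ.0≤p⇒∣p∣≡p (0≤inv p))) (inv≤1 p)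

    tauSeriesTerm-suc : ∀ m i → tauSeriesTerm (suc m) p 0 (suc i) ≡ y * tauSeriesTerm (suc m) p 0 i + tauSeriesTerm m p 0 (suc i)
    tauSeriesTerm-suc m i = begin
      τ (suc m) (p ^ suc i) * inv (p ^ suc i)
        ≡⟨ cong₂ _*_ (τ-suc-p^suc m i) (inv-p^ (suc i)) ⟩
      (τ (suc m) (p ^ i) + τ m (p ^ suc i)) * (y * powℚ y i)
        ≡⟨ solve 4 (λ a b y w → (a :+ b) :* (y :* w) := y :* (a :* w) :+ b :* (y :* w)) refl (τ (suc m) (p ^ i)) (τ m (p ^ suc i)) y (powℚ y i) ⟩
      y * (τ (suc m) (p ^ i) * powℚ y i) + τ m (p ^ suc i) * (y * powℚ y i)
        ≡⟨ cong₂ (λ u v → y * (τ (suc m) (p ^ i) * u) + τ m (p ^ suc i) * v) (inv-p^ i) (inv-p^ (suc i)) ⟨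
      y * tauSeriesTerm (suc m) p 0 i + tauSeriesTerm m p 0 (suc i) ∎
      where open ≡-Reasoning

    tauPartialSum : ℕ → ℕ → ℚ
    tauPartialSum m n = sumℚ n (tauSeriesTerm m p 0)

    tauPartialSum-suc : ∀ m n → tauPartialSum (suc m) (suc n) ≡ y * tauPartialSum (suc m) n + tauPartialSum m (suc n)
    tauPartialSum-suc m zero = begin
      0ℚ + τ (suc m) 1 * 1ℚ          ≡⟨ cong (λ z → 0ℚ + z * 1ℚ) (trans (τ-1 (suc m)) (sym (τ-1 m))) ⟩
      0ℚ + τ m 1 * 1ℚ                ≡⟨ solve 2 (λ y a → a := y :* con 0ℚ :+ a) refl y (0ℚ + τ m 1 * 1ℚ) ⟩
      y * 0ℚ + (0ℚ + τ m 1 * 1ℚ)     ∎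
      where open ≡-Reasoning
    tauPartialSum-suc m (suc n) = begin
      tauPartialSum (suc m) (suc n) + tauSeriesTerm (suc m) p 0 (suc n)
        ≡⟨ cong₂ _+_ (tauPartialSum-suc m n) (tauSeriesTerm-suc m n) ⟩
      (y * a + b) + (y * c + d)
        ≡⟨ solve 5 (λ y a b c d → (y :* a :+ b) :+ (y :* c :+ d) := y :* (a :+ c) :+ (b :+ d)) refl y a b c d ⟩
      y * (a + c) + (b + d) ∎
      where
      open ≡-Reasoning
      a = tauPartialSum (suc m) n
      b = tauPartialSum m (suc n)
      c = tauSeriesTerm (suc m) p 0 n
      d = tauSeriesTerm m p 0 (suc n)

    tauPartialSum₀ : ∀ n → tauPartialSum 0 (suc n) ≡ 1ℚ
    tauPartialSum₀ zero    = refl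
    tauPartialSum₀ (suc n) = begin
      tauPartialSum 0 (suc n) + τ 0 (p ^ suc n) * inv (p ^ suc n)  ≡⟨ cong₂ (λ u v → u + v * inv (p ^ suc n)) (tauPartialSum₀ n) (τ₀-p^suc n) ⟩
      1ℚ + 0ℚ * inv (p ^ suc n)                                    ≡⟨ cong (1ℚ +_) (ℚ.*-zeroˡ (inv (p ^ suc n))) ⟩
      1ℚ + 0ℚ                                                      ≡⟨ ℚ.+-identityʳ 1ℚ ⟩
      1ℚ                                                           ∎
      where open ≡-Reasoning

    module _ (T : ℕ → ℕ → ℕ → ℚ) (T-sums : TauSums T) where

      T₀ : T 0 p 0 ≡ 1ℚ
      T₀ = tendsto-unique {s = tauPartialSum 0} (T-sums 0 p 0 p-prime)
        (tendsto-eventually-const {s = tauPartialSum 0} 1 (λ { (suc n) _ → tauPartialSum₀ n }))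

      T-suc : ∀ m → T (suc m) p 0 ≡ y * T (suc m) p 0 + T m p 0
      T-suc m = tendsto-unique {s = λ n → tauPartialSum (suc m) (suc n)}
        (tendsto-suc {s = tauPartialSum (suc m)} (T-sums (suc m) p 0 p-prime))
        (tendsto-cong {s = λ n → y * tauPartialSum (suc m) n + tauPartialSum m (suc n)} (λ n → sym (tauPartialSum-suc m n))
          (tendsto-+ {s = λ n → y * tauPartialSum (suc m) n} {t = λ n → tauPartialSum m (suc n)}
                     (tendsto-*ˡ {s = tauPartialSum (suc m)} y ∣y∣≤1 (T-sums (suc m) p 0 p-prime))
                     (tendsto-suc {s = tauPartialSum m} (T-sums m p 0 p-prime))))

      σ1-p^0≡1 : ∀ m → σ1 T m p 0 ≡ 1ℚ
      σ1-p^0≡1 zero    = trans (ℚ.*-identityˡ _) T₀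
      σ1-p^0≡1 (suc m) = begin
        (x * powℚ x m) * T (suc m) p 0   ≡⟨ solve 3 (λ a b c → (a :* b) :* c := b :* (a :* c)) refl x (powℚ x m) (T (suc m) p 0) ⟩
        powℚ x m * (x * T (suc m) p 0)   ≡⟨ cong (powℚ x m *_) x*T-suc ⟩
        powℚ x m * T m p 0               ≡⟨ σ1-p^0≡1 m ⟩
        1ℚ                               ∎
        where
        open ≡-Reasoning
        x = oneMinusInv p
        x*T-suc : x * T (suc m) p 0 ≡ T m p 0
        x*T-suc = begin
          (1ℚ - y) * T (suc m) p 0                       ≡⟨ solve 2 (λ y a → (con 1ℚ :- y) :* a := a :- y :* a) refl y (T (suc m) p 0) ⟩
          T (suc m) p 0 - y * T (suc m) p 0              ≡⟨ cong (_- y * T (suc m) p 0) (T-suc m) ⟩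
          (y * T (suc m) p 0 + T m p 0) - y * T (suc m) p 0 ≡⟨ solve 3 (λ y a b → (y :* a :+ b) :- y :* a := b) refl y (T (suc m) p 0) (T m p 0) ⟩
          T m p 0                                        ∎

      binomSeriesTerm≡tauSeriesTerm : ∀ m j i → binomSeriesTerm (suc m) p (suc j) i ≡ tauSeriesTerm m p (suc j) i
      binomSeriesTerm≡tauSeriesTerm zero    j i = cong (_* inv (p ^ i)) (sym (τ₀-p^suc (j ℕ.+ i)))
      binomSeriesTerm≡tauSeriesTerm (suc m) j i = cong (_* inv (p ^ i)) (sym (τ-suc-p^≡C m (suc j ℕ.+ i)))

      S≡T : ∀ S → BinomSums S → ∀ m j → S (suc m) p (suc j) ≡ T m p (suc j)
      S≡T S S-sums m j = tendsto-unique {s = λ n → sumℚ n (tauSeriesTerm m p (suc j))}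
        (tendsto-cong {s = λ n → sumℚ n (binomSeriesTerm (suc m) p (suc j))}
          (λ n → sumℚ-cong n (λ i _ → binomSeriesTerm≡tauSeriesTerm m j i)) (S-sums (suc m) p (suc j) p-prime (s≤s z≤n)))
        (T-sums m p (suc j) p-prime)

      module _ (S : ℕ → ℕ → ℕ → ℚ) (S-sums : BinomSums S) (k ℓ : ℕ) where

        private
          A : ℕ → ℚ
          A j = Akl S (suc k) (suc ℓ) p j

          B : ℕ → ℚ
          B j = σ1 T k p j * σ1 T ℓ p j

          x = oneMinusInv p

          A≡B : ∀ j → A (suc j) ≡ B (suc j)
          A≡B j = begin
            powℚ x ((suc k ℕ.+ suc ℓ) ∸ 2) * (S (suc k) p (suc j) * S (suc ℓ) p (suc j))
              ≡⟨ cong₂ _*_ (powℚ-[k+ℓ]∸2 x k ℓ) (cong₂ _*_ (S≡T S S-sums k j) (S≡T S S-sums ℓ j)) ⟩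
            (powℚ x k * powℚ x ℓ) * (T k p (suc j) * T ℓ p (suc j))
              ≡⟨ *-interchange (powℚ x k) (powℚ x ℓ) (T k p (suc j)) (T ℓ p (suc j)) ⟩
            B (suc j) ∎
            where open ≡-Reasoning

        open Telescoping (toℚ p) y (inv*toℚ≡1 (suc q)) A B (cong₂ _*_ (σ1-p^0≡1 k) (σ1-p^0≡1 ℓ)) A≡B

        fFactor≡gFactor : ∀ a → fFactor S (suc k) (suc ℓ) p a ≡ gFactor T (suc k) (suc ℓ) p a
        fFactor≡gFactor a = cong₂ divℚ (begin
          (1ℚ + sumℚ a (λ i → (toℚ (p ^ suc i) - toℚ (p ^ i)) * (A (suc i) * inv (p ^ (2 ℕ.* suc i)))))
            - toℚ (p ^ a) * (A (suc a) * inv (p ^ (2 ℕ.* suc a)))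
            ≡⟨ cong₂ (λ u v → (1ℚ + u) - v)
                 (sumℚ-cong a (λ i _ → cong₂ (λ u v → u * (A (suc i) * v)) (cong₂ _-_ (toℚ-^ p (suc i)) (toℚ-^ p i)) (inv-p^ (2 ℕ.* suc i))))
                 (cong₂ (λ u v → u * (A (suc a) * v)) (toℚ-^ p a) (inv-p^ (2 ℕ.* suc a))) ⟩
          (1ℚ + sumℚ a (λ i → (powℚ (toℚ p) (suc i) - powℚ (toℚ p) i) * (A (suc i) * powℚ y (2 ℕ.* suc i))))
            - powℚ (toℚ p) a * (A (suc a) * powℚ y (2 ℕ.* suc a))
            ≡⟨ telescoping a ⟨
          sumℚ (suc a) (λ j → B j * powℚ y j - B (suc j) * powℚ y (j ℕ.+ 2))
            ≡⟨ sumℚ-cong (suc a) (λ j _ → cong₂ (λ u v → B j * u - B (suc j) * v) (inv-p^ j) (inv-p^ (j ℕ.+ 2))) ⟨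
          sumℚ (suc a) (λ j → B j * inv (p ^ j) - B (suc j) * inv (p ^ (j ℕ.+ 2))) ∎)
          (Cfactor≡Dp k ℓ p)
          where open ≡-Reasoning

  prodList-++ : ∀ xs ys → prodList (xs ++ ys) ≡ prodList xs * prodList ys
  prodList-++ []       ys = sym (ℚ.*-identityˡ _)
  prodList-++ (x ∷ xs) ys = trans (cong (x *_) (prodList-++ xs ys)) (sym (ℚ.*-assoc x _ _))

  extendByOne : ∀ {p} {P : Pred ℕ p} → Decidable P → (ℕ → ℚ) → ℕ → ℚ
  extendByOne P? f n = if does (P? n) then f n else 1ℚ

  extendByOne-elim : ∀ {p} {P : Pred ℕ p} (P? : Decidable P) f (Q : ℚ → Set) {n} →
                     (P n → Q (f n)) → (¬ P n → Q 1ℚ) → Q (extendByOne P? f n)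
  extendByOne-elim P? f Q {n} Q-f Q-1 with P? n
  ... | yes Pn  = Q-f Pn
  ... | no  ¬Pn = Q-1 ¬Pn

  prodList-filter : ∀ {p} {P : Pred ℕ p} (P? : Decidable P) f xs →
                    prodList (map f (filter P? xs)) ≡ prodList (map (extendByOne P? f) xs)
  prodList-filter P? f []       = refl
  prodList-filter P? f (x ∷ xs) with P? x
  ... | yes _ = cong (f x *_) (prodList-filter P? f xs)
  ... | no  _ = trans (prodList-filter P? f xs) (sym (ℚ.*-identityˡ _))

  prodUpTo : (ℕ → ℚ) → ℕ → ℚ
  prodUpTo E M = prodList (map E (upTo M))

  prodUpTo-suc : ∀ E M → prodUpTo E (suc M) ≡ prodUpTo E M * E M
  prodUpTo-suc E M = begin
    prodList (map E (upTo (suc M)))               ≡⟨ cong (prodList ∘ map E) (List.upTo-∷ʳ M) ⟨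
    prodList (map E (upTo M ++ [ M ]))            ≡⟨ cong prodList (List.map-++ E (upTo M) [ M ]) ⟩
    prodList (map E (upTo M) ++ [ E M ])          ≡⟨ prodList-++ (map E (upTo M)) [ E M ] ⟩
    prodUpTo E M * (E M * 1ℚ)                     ≡⟨ cong (prodUpTo E M *_) (ℚ.*-identityʳ (E M)) ⟩
    prodUpTo E M * E M                            ∎
    where open ≡-Reasoning

  prodList-map-filter-cong : ∀ {p} {P : Pred ℕ p} (P? : Decidable P) (F G : ℕ → ℚ) → (∀ n → P n → F n ≡ G n) →
                             ∀ xs → prodList (map F (filter P? xs)) ≡ prodList (map G (filter P? xs))
  prodList-map-filter-cong P? F G F≡G []       = refl
  prodList-map-filter-cong P? F G F≡G (x ∷ xs) with P? x
  ... | yes Px = cong₂ _*_ (F≡G x Px) (prodList-map-filter-cong P? F G F≡G xs)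
  ... | no  _  = prodList-map-filter-cong P? F G F≡G xs

  prodOverPrimeDivisors-cong : ∀ h F G → (∀ p → Prime p → ∀ a → F p a ≡ G p a) →
                               prodOverPrimeDivisors h F ≡ prodOverPrimeDivisors h G
  prodOverPrimeDivisors-cong h F G F≡G = prodList-map-filter-cong (λ p → prime? p ×-dec p ∣? ℤ.∣ h ∣) _ _
    (λ p (p-prime , _) → F≡G p p-prime (ν p ℤ.∣ h ∣)) (upTo (suc ℤ.∣ h ∣))

  module _ (E c : ℕ → ℚ) (n₀ : ℕ) (E∈[0,1] : ∀ n → E n ∈[0,1])
           (1-E≤Δc : ∀ n → n₀ ℕ.≤ n → 1ℚ - E n ≤ c n - c (suc n))
           (0≤c : ∀ n → 0ℚ ≤ c n)
           (c-small : ∀ ε → 0ℚ < ε → ∃[ N ] (n₀ ℕ.≤ N × c N < ε)) where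

    private
      s = prodUpTo E

      s∈[0,1] : ∀ M → s M ∈[0,1]
      s∈[0,1] zero    = 1∈[0,1]
      s∈[0,1] (suc M) = subst _∈[0,1] (sym (prodUpTo-suc E M)) (*-∈[0,1] (s∈[0,1] M) (E∈[0,1] M))

      s-antitone : ∀ N r → s (r ℕ.+ N) ≤ s N
      s-antitone N zero    = ℚ.≤-refl
      s-antitone N (suc r) = ℚ.≤-trans (subst₂-≤ (sym (prodUpTo-suc E (r ℕ.+ N))) (ℚ.*-identityʳ _)
        (ℚ.*-monoˡ-≤-nonNeg (s (r ℕ.+ N)) {{ℚ.nonNegative (proj₁ (s∈[0,1] (r ℕ.+ N)))}} (proj₂ (E∈[0,1] (r ℕ.+ N)))))
        (s-antitone N r)

      s-drop : ∀ N r → n₀ ℕ.≤ N → s N - s (r ℕ.+ N) ≤ c N - c (r ℕ.+ N)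
      s-drop N zero    n₀≤N = ℚ.≤-reflexive (trans (ℚ.+-inverseʳ (s N)) (sym (ℚ.+-inverseʳ (c N))))
      s-drop N (suc r) n₀≤N = begin
        s N - s (suc M)                        ≡⟨ cong (λ z → s N - z) (prodUpTo-suc E M) ⟩
        s N - s M * E M                        ≡⟨ solve 3 (λ a b e → a :- b :* e := (a :- b) :+ b :* (con 1ℚ :- e)) refl (s N) (s M) (E M) ⟩
        (s N - s M) + s M * (1ℚ - E M)         ≤⟨ ℚ.+-mono-≤ (s-drop N r n₀≤N)
                                                    (ℚ.*-monoʳ-≤-nonNeg (1ℚ - E M) {{ℚ.nonNegative (proj₁ (1-p∈[0,1] (E∈[0,1] M)))}} (proj₂ (s∈[0,1] M))) ⟩
        (c N - c M) + 1ℚ * (1ℚ - E M)          ≤⟨ ℚ.+-monoʳ-≤ (c N - c M) (subst (_≤ c M - c (suc M)) (sym (ℚ.*-identityˡ _))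
                                                    (1-E≤Δc M (ℕ.≤-trans n₀≤N (ℕ.m≤n+m N r)))) ⟩
        (c N - c M) + (c M - c (suc M))        ≡⟨ solve 3 (λ a b d → (a :- b) :+ (b :- d) := a :- d) refl (c N) (c M) (c (suc M)) ⟩
        c N - c (suc M)                        ∎
        where
        open ℚ.≤-Reasoning
        M = r ℕ.+ N

      s-between : ∀ N m → n₀ ℕ.≤ N → N ℕ.≤ m → s N - c N ≤ s m × s m ≤ s N
      s-between N m n₀≤N N≤m = subst (λ k → s N - c N ≤ s k × s k ≤ s N) (ℕ.m∸n+n≡m N≤m) (lower , s-antitone N (m ∸ N))
        where
        M = m ∸ N ℕ.+ N
        lower : s N - c N ≤ s M
        lower = p-q≤r⇒p-r≤q {s N} (ℚ.≤-trans (s-drop N (m ∸ N) n₀≤N) (0≤q⇒p-q≤p {c N} (0≤c M)))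

    prodUpTo-cauchy : Cauchy (prodUpTo E)
    prodUpTo-cauchy ε 0<ε with c-small ε 0<ε
    ... | N , n₀≤N , cN<ε = N , λ m n N≤m N≤n →
      let (lm , um) = s-between N m n₀≤N N≤m
          (ln , un) = s-between N n n₀≤N N≤n
      in ℚ.≤-<-trans (∣u-v∣≤U-L lm um ln un) (subst (_< ε) (solve 2 (λ a d → d := a :- (a :- d)) refl (s N) (c N)) cN<ε)

  bernoulli : ∀ {y} a → y ∈[0,1] → 1ℚ - powℚ (1ℚ - y) a ≤ toℚ a * y
  bernoulli {y} zero    _  = ℚ.≤-reflexive (trans (ℚ.+-inverseʳ 1ℚ) (sym (ℚ.*-zeroˡ y)))
  bernoulli {y} (suc a) y∈ = begin
    1ℚ - (1ℚ - y) * w              ≡⟨ solve 2 (λ y w → con 1ℚ :- (con 1ℚ :- y) :* w := (con 1ℚ :- w) :+ w :* y) refl y w ⟩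
    (1ℚ - w) + w * y               ≤⟨ ℚ.+-mono-≤ (bernoulli a y∈) (ℚ.*-monoʳ-≤-nonNeg y {{ℚ.nonNegative (proj₁ y∈)}} (proj₂ w∈)) ⟩
    toℚ a * y + 1ℚ * y             ≡⟨ solve 2 (λ t y → t :* y :+ con 1ℚ :* y := (con 1ℚ :+ t) :* y) refl (toℚ a) y ⟩
    (1ℚ + toℚ a) * y               ≡⟨ cong (_* y) (toℚ-suc a) ⟨
    toℚ (suc a) * y                ∎
    where
    open ℚ.≤-Reasoning
    w = powℚ (1ℚ - y) a
    w∈ = powℚ-∈[0,1] a (1-p∈[0,1] y∈)

  inv∈[0,1] : ∀ n → inv n ∈[0,1]
  inv∈[0,1] n = 0≤inv n , inv≤1 n

  1-oneMinusInv^∈[0,1] : ∀ n a → (1ℚ - powℚ (oneMinusInv n) a) ∈[0,1]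
  1-oneMinusInv^∈[0,1] n a = 1-p∈[0,1] (powℚ-∈[0,1] a (1-p∈[0,1] (inv∈[0,1] n)))

  Cfactor-∈[0,1] : ∀ a b n → Cfactor (suc a) (suc b) n ∈[0,1]
  Cfactor-∈[0,1] a b n = 1-p∈[0,1] (*-∈[0,1] (1-oneMinusInv^∈[0,1] n a) (1-oneMinusInv^∈[0,1] n b))

  1-Cfactor≤ : ∀ a b m → 1ℚ - Cfactor (suc a) (suc b) (suc (suc m)) ≤ (toℚ a * toℚ b) * (inv (suc m) - inv (suc (suc m)))
  1-Cfactor≤ a b m = begin
    1ℚ - (1ℚ - ((1ℚ - powℚ x a) * (1ℚ - powℚ x b)))  ≡⟨ solve 1 (λ c → con 1ℚ :- (con 1ℚ :- c) := c) refl ((1ℚ - powℚ x a) * (1ℚ - powℚ x b)) ⟩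
    (1ℚ - powℚ x a) * (1ℚ - powℚ x b)                ≤⟨ *-mono-≤-nonNeg (proj₁ (1-oneMinusInv^∈[0,1] n a)) (proj₁ (1-oneMinusInv^∈[0,1] n b))
                                                                          (bernoulli a (inv∈[0,1] n)) (bernoulli b (inv∈[0,1] n)) ⟩
    (toℚ a * y) * (toℚ b * y)                        ≡⟨ solve 3 (λ a b y → (a :* y) :* (b :* y) := (a :* b) :* (y :* y)) refl (toℚ a) (toℚ b) y ⟩
    (toℚ a * toℚ b) * (y * y)                        ≤⟨ ℚ.*-monoˡ-≤-nonNeg (toℚ a * toℚ b) {{ℚ.nonNegative (0≤* (0≤toℚ a) (0≤toℚ b))}}
                                                          (ℚ.*-monoʳ-≤-nonNeg y {{ℚ.nonNegative (0≤inv n)}} (inv-antitone m)) ⟩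
    (toℚ a * toℚ b) * (inv (suc m) * y)              ≡⟨ cong ((toℚ a * toℚ b) *_) (inv[1+n]-inv[2+n]≡inv[1+n]*inv[2+n] m) ⟨
    (toℚ a * toℚ b) * (inv (suc m) - y)              ∎
    where
    open ℚ.≤-Reasoning
    n = suc (suc m)
    x = oneMinusInv n
    y = inv n

  partialProdPrimes-Cfactor-cauchy : ∀ a b → Cauchy (partialProdPrimes (Cfactor (suc a) (suc b)))
  partialProdPrimes-Cfactor-cauchy a b = cauchy-cong (λ N → sym (prodList-filter prime? F (upTo (suc N))))
    (cauchy-suc {prodUpTo E} (prodUpTo-cauchy E c 2 E∈[0,1] 1-E≤Δc 0≤c c-small))
    where
    F = Cfactor (suc a) (suc b)
    E = extendByOne prime? F
    K = toℚ a * toℚ b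
    -- inv 0 = 0 makes c vanish below 2, hence n₀ = 2.
    c : ℕ → ℚ
    c n = K * inv (n ∸ 1)
    0≤K = 0≤* (0≤toℚ a) (0≤toℚ b)
    E∈[0,1] : ∀ n → E n ∈[0,1]
    E∈[0,1] n = extendByOne-elim prime? F _∈[0,1] {n} (λ _ → Cfactor-∈[0,1] a b n) (λ _ → 1∈[0,1])
    0≤c : ∀ n → 0ℚ ≤ c n
    0≤c n = 0≤* 0≤K (0≤inv (n ∸ 1))
    Δc≡ : ∀ m → c (suc (suc m)) - c (suc (suc (suc m))) ≡ K * (inv (suc m) - inv (suc (suc m)))
    Δc≡ m = solve 3 (λ K u v → K :* u :- K :* v := K :* (u :- v)) refl K (inv (suc m)) (inv (suc (suc m)))
    1-E≤Δc : ∀ n → 2 ℕ.≤ n → 1ℚ - E n ≤ c n - c (suc n)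
    1-E≤Δc 0             ()
    1-E≤Δc 1             (s≤s ())
    1-E≤Δc (suc (suc m)) _ = extendByOne-elim prime? F (λ e → 1ℚ - e ≤ c (suc (suc m)) - c (suc (suc (suc m)))) {suc (suc m)}
      (λ _ → subst (1ℚ - F (suc (suc m)) ≤_) (sym (Δc≡ m)) (1-Cfactor≤ a b m))
      (λ _ → subst₂-≤ (sym (ℚ.+-inverseʳ 1ℚ)) (sym (Δc≡ m)) (0≤* 0≤K (p≤q⇒0≤q-p (inv-antitone m))))
    c-small : ∀ ε → 0ℚ < ε → ∃[ N ] (2 ℕ.≤ N × c N < ε)
    c-small ε 0<ε with toℚ*inv-small (a ℕ.* b) ε 0<ε
    ... | N , ab/[1+N]<ε = suc (suc N) , s≤s (s≤s z≤n) , subst (λ z → z * inv (suc N) < ε) (toℚ-* a b) ab/[1+N]<ε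

  partialProducts-cauchy-sameLimit : ∀ k ℓ → 1 ℕ.≤ k → 1 ℕ.≤ ℓ →
    Cauchy (partialProdPrimes (Cfactor k ℓ)) × Cauchy (partialProdPrimes (Dp k ℓ))
    × SameLimit (partialProdPrimes (Cfactor k ℓ)) (partialProdPrimes (Dp k ℓ))
  partialProducts-cauchy-sameLimit (suc a) (suc b) _ _ =
    partialProdPrimes-Cfactor-cauchy a b , cauchy-cong C≡D (partialProdPrimes-Cfactor-cauchy a b) , sameLimit-≡ C≡D
    where
    C≡D : ∀ N → partialProdPrimes (Cfactor (suc a) (suc b)) N ≡ partialProdPrimes (Dp (suc a) (suc b)) N
    C≡D N = cong prodList (List.map-cong (Cfactor≡Dp a b) (primesUpTo N))

  fFactor≡gFactor : ∀ k ℓ → 1 ℕ.≤ k → 1 ℕ.≤ ℓ → ∀ S T → BinomSums S → TauSums T →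
                    ∀ p → Prime p → ∀ a → fFactor S k ℓ p a ≡ gFactor T k ℓ p a
  fFactor≡gFactor (suc k) (suc ℓ) _ _ S T S-sums T-sums (suc (suc q)) p-prime a =
    PrimePower.fFactor≡gFactor q p-prime T T-sums S S-sums k ℓ a
  fFactor≡gFactor (suc k) (suc ℓ) _ _ S T S-sums T-sums 0       p-prime = ⊥-elim (¬prime[0] p-prime)
  fFactor≡gFactor (suc k) (suc ℓ) _ _ S T S-sums T-sums 1       p-prime = ⊥-elim (¬prime[1] p-prime)

open EulerFactors using (partialProducts-cauchy-sameLimit; prodOverPrimeDivisors-cong; fFactor≡gFactor)
open import Data.Nat using (ℕ; _≤_)
open import Data.Nat.Divisibility using (_∣_)
open import Data.Nat.Primality using (Prime)
open import Data.Integer using (ℤ; ∣_∣; 0ℤ)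
open import Data.Rational using (ℚ)
open import Data.Product using (_×_; _,_)
open import Relation.Binary.PropositionalEquality using (_≡_; _≢_)

mainTheorem1 : ∀ (k ℓ : ℕ) → 1 ≤ k → 1 ≤ ℓ →
    -- (i) the infinite products over primes exist and are equal
    ( Cauchy (partialProdPrimes (Cfactor k ℓ))
    × Cauchy (partialProdPrimes (Dp k ℓ))
    × SameLimit (partialProdPrimes (Cfactor k ℓ)) (partialProdPrimes (Dp k ℓ)) )
    ×
    -- (ii) f_{k,ℓ}(h) = Π_{p ∣ h} g_{k,ℓ}(p^{ν_p(h)}), factor by factor
    ( ∀ (S T : ℕ → ℕ → ℕ → ℚ) → BinomSums S → TauSums T →
      ∀ (h : ℤ) → h ≢ 0ℤ →
        ( prodOverPrimeDivisors h (fFactor S k ℓ) ≡ prodOverPrimeDivisors h (gFactor T k ℓ) )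
        × ( ∀ (p : ℕ) → Prime p → p ∣ ∣ h ∣ →
              fFactor S k ℓ p (ν p ∣ h ∣) ≡ gFactor T k ℓ p (ν p ∣ h ∣) ) )
mainTheorem1 k ℓ 1≤k 1≤ℓ = partialProducts-cauchy-sameLimit k ℓ 1≤k 1≤ℓ , λ S T S-sums T-sums h _ →
  let factor = fFactor≡gFactor k ℓ 1≤k 1≤ℓ S T S-sums T-sums
  in prodOverPrimeDivisors-cong h _ _ factor , λ p p-prime _ → factor p p-prime (ν p ∣ h ∣)
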